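{- Let $F$ be a clause-irreducible unsatisfiable hitting clause-set. The following are equivalent: (i) $F$ has a singular variable; (ii) $F$ has a full variable; (iii) $F$ contains an fs-pair; (iv) $F$ contains a unit-clause; (v) $F=\{\{v\},\{\overline v\}\}$ for some variable $v$.
   Context: Variables are positive integers, literals are nonzero integers, the complement of $x$ is $\overline{x}=-x$. A clause is a finite set of literals with no pair $x,\overline{x}$; a unit-clause is a clause with exactly one literal. A clause-set is a finite set of clauses; $\top$ is the empty clause-set; $c(F)=|F|$. $F$ is satisfiable if some clause meets every clause of $F$, otherwise unsatisfiable. $F$ is hitting if any two distinct clauses $C,D\in F$ have some $x\in C$ with $\overline{x}\in D$. $\mathrm{ldeg}_F(x)$ is the number of clauses containing $x$; a variable $v$ of $F$ is singular if $\min(\mathrm{ldeg}_F(v),\mathrm{ldeg}_F(\overline v))=1$. A full variable of $F$ is a variable occurring in every clause of $F$. An fs-pair is a pair of clauses $\{E\cup\{v\},E\cup\{\overline v\}\}$ with $v,\overline v\notin E$. A clause-set $F'\ne\top$ is a clause-factor if $\{D\setminus\bigcap F':D\in F'\}$ is unsatisfiable; a clause-factor of $F$ is a subset of $F$ which is a clause-factor; trivial if $c(F')=1$ or ($F'$ unsatisfiable and $F'=F$). $F$ is clause-irreducible if all its clause-factors are trivial. -}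

module Defs where

open import Data.Integer using (ℤ; _<_; -_; 0ℤ; +_)
open import Data.Integer.Properties using (_≟_)
open import Data.Nat using (ℕ; _⊓_)
open import Data.List using (List; []; _∷_; length; filter; map)
open import Data.List.Relation.Unary.All using (All; all?)
open import Data.List.Relation.Unary.Linked using (Linked)
open import Data.List.Relation.Unary.Unique.Propositional using (Unique)
open import Data.List.Membership.Propositional using (_∈_; _∉_)
open import Data.List.Membership.DecPropositional _≟_ using (_∈?_)
open import Data.Product using (Σ; ∃; ∃-syntax; _×_)
open import Data.Sum using (_⊎_)
open import Relation.Nullary using (¬_; ¬?)
open import Relation.Binary.PropositionalEquality using (_≡_; _≢_)
open import Function.Bundles using (_⇔_)

-- Literals are nonzero integers; the complement of x is - x.
Lit : Set
Lit = ℤ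

IsVar : ℤ → Set
IsVar v = 0ℤ < v

-- Clauses are represented canonically as strictly increasing lists of
-- nonzero integers (so that equality of clauses is _≡_), without a
-- complementary pair.
IsClause : List Lit → Set
IsClause C = Linked _<_ C × All (λ x → x ≢ 0ℤ) C × (∀ x → x ∈ C → - x ∉ C)

-- A clause-set: a duplicate-free list of clauses (a finite set of clauses).
IsClauseSet : List (List Lit) → Set
IsClauseSet F = All IsClause F × Unique F

c : List (List Lit) → ℕ
c F = length F

-- Satisfiable: some clause meets every clause of F.
-- (Only membership is used, so this also makes sense for arbitrary lists of lists.)
Satisfiable : List (List Lit) → Set
Satisfiable F = ∃[ C ] (IsClause C × All (λ D → ∃[ x ] (x ∈ C × x ∈ D)) F)

Unsatisfiable : List (List Lit) → Set
Unsatisfiable F = ¬ Satisfiable F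

Hitting : List (List Lit) → Set
Hitting F = ∀ C D → C ∈ F → D ∈ F → C ≢ D → ∃[ x ] (x ∈ C × - x ∈ D)

ldeg : List (List Lit) → Lit → ℕ
ldeg F x = length (filter (x ∈?_) F)

IsVarOf : List (List Lit) → ℤ → Set
IsVarOf F v = IsVar v × ∃[ C ] (C ∈ F × (v ∈ C ⊎ - v ∈ C))

SingularVar : List (List Lit) → ℤ → Set
SingularVar F v = IsVarOf F v × (ldeg F v ⊓ ldeg F (- v) ≡ 1)

FullVar : List (List Lit) → ℤ → Set
FullVar F v = IsVarOf F v × (∀ C → C ∈ F → v ∈ C ⊎ - v ∈ C)

SameLits : List Lit → List Lit → Set
SameLits C D = ∀ x → (x ∈ C ⇔ x ∈ D)

SameClauses : List (List Lit) → List (List Lit) → Set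
SameClauses F G = ∀ C → (C ∈ F ⇔ C ∈ G)

HasFsPair : List (List Lit) → Set
HasFsPair F = ∃[ E ] ∃[ v ] (v ∉ E × - v ∉ E ×
  (∃[ C ] (C ∈ F × SameLits C (v ∷ E))) ×
  (∃[ D ] (D ∈ F × SameLits D (- v ∷ E))))

HasUnitClause : List (List Lit) → Set
HasUnitClause F = ∃[ C ] (C ∈ F × length C ≡ 1)

InAll : List (List Lit) → Lit → Set
InAll F x = All (x ∈_) F

minusMeet : List (List Lit) → List Lit → List Lit
minusMeet F D = filter (λ x → ¬? (all? (x ∈?_) F)) D

reduce : List (List Lit) → List (List Lit)
reduce F = map (minusMeet F) F

IsClauseFactor : List (List Lit) → Set
IsClauseFactor F' = F' ≢ [] × Unsatisfiable (reduce F')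

ClauseFactorOf : List (List Lit) → List (List Lit) → Set
ClauseFactorOf F F' = IsClauseSet F' × (∀ C → C ∈ F' → C ∈ F) × IsClauseFactor F'

TrivialFactor : List (List Lit) → List (List Lit) → Set
TrivialFactor F F' = c F' ≡ 1 ⊎ (Unsatisfiable F' × SameClauses F' F)

ClauseIrreducible : List (List Lit) → Set
ClauseIrreducible F = ∀ F' → ClauseFactorOf F F' → TrivialFactor F F'

IsTwoUnit : List (List Lit) → Set
IsTwoUnit F = ∃[ v ] (IsVar v × SameClauses F ((v ∷ []) ∷ (- v ∷ []) ∷ []))

-- Each of (i)-(iv) produces a full literal x. A unit clause {x} clashes with every other
-- clause. An fs-pair {C, D} on v has reduct {{v}, {-v}}, so irreducibility forces F = {C, D}.
-- If x occurs only in C and -x occurs, the hitting property puts C ∖ {x} into every clause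
-- containing -x; then the clauses mentioning x form a clause-factor, which must be all of F.
-- For a full literal x, the clauses containing x form a clause-factor (a satisfier of its
-- reduct, together with -x, would satisfy F) that misses the clauses with -x, so it is a single
-- clause C; and C = {x}, since any other y ∈ C would make {y, -x} satisfy F. By symmetry {-x} is
-- the only clause containing -x, so F = {{x}, {-x}}.

module Submission where

open import Defs
open import Data.Integer using (ℤ; -_; 0ℤ; _<_; _≤_; +_; -[1+_])
open import Data.Integer.Properties
  using (_≟_; <-cmp; <-trans; ≤-trans; ≤-decTotalOrder; ≤∧≢⇒<; <⇒≢; neg-involutive; neg-injective; neg-mono-<)
open import Data.Nat using (zero; suc; _⊓_)
open import Data.List using (List; []; _∷_; [_]; _++_; map; filter; length; deduplicate)
open import Data.List.Properties using (filter-none; ≡-dec)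
open import Data.List.Relation.Unary.All as All using (All; []; _∷_; all?)
import Data.List.Relation.Unary.All.Properties as All
open import Data.List.Relation.Unary.Any using (here; there; any?)
open import Data.List.Relation.Unary.AllPairs as AllPairs using (AllPairs; []; _∷_)
import Data.List.Relation.Unary.AllPairs.Properties as AllPairs
open import Data.List.Relation.Unary.Linked using (Linked)
open import Data.List.Relation.Unary.Linked.Properties using (AllPairs⇒Linked; Linked⇒AllPairs)
open import Data.List.Relation.Unary.Unique.Propositional using (Unique)
open import Data.List.Relation.Unary.Unique.DecPropositional.Properties _≟_ using (deduplicate-!)
open import Data.List.Relation.Binary.Permutation.Propositional using (↭-sym)
open import Data.List.Relation.Binary.Permutation.Propositional.Properties using (∈-resp-↭)
open import Data.List.Membership.Propositional using (_∈_; _∉_; find; lose)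
open import Data.List.Membership.Propositional.Properties
  using (∈-++⁺ˡ; ∈-++⁺ʳ; ∈-++⁻; ∈-filter⁺; ∈-filter⁻; ∈-map⁺; ∈-map⁻; ∈-deduplicate⁺; ∈-deduplicate⁻)
open import Data.List.Membership.DecPropositional _≟_ using (_∈?_)
open import Data.List.Sort ≤-decTotalOrder using (sort; sort-↭; sort-↗)
open import Data.Product using (_×_; _,_; proj₁; proj₂; ∃-syntax)
open import Data.Sum using (_⊎_; inj₁; inj₂)
open import Data.Empty using (⊥-elim)
open import Function.Base using (_∘_; id; case_of_)
open import Function.Bundles using (_⇔_; mk⇔; Equivalence)
open import Relation.Binary.Definitions using (tri<; tri≈; tri>)
open import Relation.Binary.PropositionalEquality using (_≡_; _≢_; refl; sym; trans; cong; cong₂; subst)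
open import Relation.Nullary using (¬_; ¬?; yes; no)
open import Relation.Nullary.Decidable using (_⊎-dec_)
open import Relation.Unary using (Pred; Decidable)

private
  variable
    A : Set
    P : Pred A _
    x y a : Lit
    xs : List A
    C D E L X : List Lit
    F G : List (List Lit)

-x≢x : x ≢ 0ℤ → - x ≢ x
-x≢x {+ zero} x≢0 _ = x≢0 refl
-x≢x {+ suc _} _ ()
-x≢x { -[1+ _ ]} _ ()

-x≢0 : x ≢ 0ℤ → - x ≢ 0ℤ
-x≢0 x≢0 = x≢0 ∘ neg-injective

var≢0 : IsVar x → x ≢ 0ℤ
var≢0 0<x = <⇒≢ 0<x ∘ sym

-- Consistent lists of literals

-- IsClause C unfolds to Linked _<_ C × Consistent C.
Consistent : List Lit → Set
Consistent L = All (λ x → x ≢ 0ℤ) L × (∀ x → x ∈ L → - x ∉ L)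

Meets : List Lit → List Lit → Set
Meets L D = ∃[ x ] (x ∈ L × x ∈ D)

[-]-consistent : x ≢ 0ℤ → Consistent [ x ]
[-]-consistent x≢0 = x≢0 ∷ [] , λ { _ (here refl) (here -x≡x) → -x≢x x≢0 -x≡x }

∈-neg⁻ : x ∈ map -_ L → - x ∈ L
∈-neg⁻ x∈ with ∈-map⁻ -_ x∈
... | y , y∈L , refl = subst (_∈ _) (sym (neg-involutive y)) y∈L

neg-consistent : Consistent L → Consistent (map -_ L)
neg-consistent (nonzero , noClash) =
  All.map⁺ (All.map -x≢0 nonzero) ,
  λ x x∈ -x∈ → noClash (- x) (∈-neg⁻ x∈) (∈-neg⁻ -x∈)

-- Opaque, so that L and X can be inferred from the type x ∈ L ⊕ X.
opaque
  _⊕_ : List Lit → List Lit → List Lit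
  L ⊕ X = L ++ filter (λ z → ¬? (- z ∈? L)) X

  ∈-⊕ˡ : x ∈ L → x ∈ L ⊕ X
  ∈-⊕ˡ = ∈-++⁺ˡ

  ∈-⊕ʳ : x ∈ X → - x ∉ L → x ∈ L ⊕ X
  ∈-⊕ʳ {L = L} x∈X -x∉L = ∈-++⁺ʳ L (∈-filter⁺ (λ z → ¬? (- z ∈? L)) x∈X -x∉L)

  ∈-⊕⁻ : x ∈ L ⊕ X → x ∈ L ⊎ (x ∈ X × - x ∉ L)
  ∈-⊕⁻ {L = L} x∈ with ∈-++⁻ L x∈
  ... | inj₁ x∈L = inj₁ x∈L
  ... | inj₂ x∈X = inj₂ (∈-filter⁻ (λ z → ¬? (- z ∈? L)) x∈X)

  ⊕-consistent : Consistent L → Consistent X → Consistent (L ⊕ X)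
  ⊕-consistent {L} {X} (nonzeroL , noClashL) (nonzeroX , noClashX) =
    All.++⁺ nonzeroL (All.filter⁺ (λ z → ¬? (- z ∈? L)) nonzeroX) , noClash
    where
    noClash : ∀ x → x ∈ L ⊕ X → - x ∉ L ⊕ X
    noClash x x∈ -x∈ with ∈-⊕⁻ {X = X} x∈ | ∈-⊕⁻ {X = X} -x∈
    ... | inj₁ x∈L        | inj₁ -x∈L        = noClashL x x∈L -x∈L
    ... | inj₁ x∈L        | inj₂ (_ , x∉L)   = x∉L (subst (_∈ L) (sym (neg-involutive x)) x∈L)
    ... | inj₂ (_ , -x∉L) | inj₁ -x∈L        = -x∉L -x∈L
    ... | inj₂ (x∈X , _)  | inj₂ (-x∈X , _)  = noClashX x x∈X -x∈X

normalise : List Lit → List Lit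
normalise L = deduplicate _≟_ (sort L)

deduplicate-sorted : AllPairs _≤_ xs → AllPairs _≤_ (deduplicate _≟_ xs)
deduplicate-sorted [] = []
deduplicate-sorted (x≤xs ∷ sorted) =
  All.filter⁺ _ (All.deduplicate⁺ _≟_ x≤xs) ∷ AllPairs.filter⁺ _ (deduplicate-sorted sorted)

normalise-strictlySorted : ∀ L → Linked _<_ (normalise L)
normalise-strictlySorted L =
  AllPairs⇒Linked (AllPairs.zipWith (λ (x≤y , x≢y) → ≤∧≢⇒< x≤y x≢y)
    (deduplicate-sorted (Linked⇒AllPairs ≤-trans (sort-↗ L)) , deduplicate-! (sort L)))

∈-normalise⁺ : x ∈ L → x ∈ normalise L
∈-normalise⁺ {L = L} x∈L = ∈-deduplicate⁺ _≟_ (∈-resp-↭ (↭-sym (sort-↭ L)) x∈L)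

∈-normalise⁻ : x ∈ normalise L → x ∈ L
∈-normalise⁻ {L = L} x∈ = ∈-resp-↭ (sort-↭ L) (∈-deduplicate⁻ _≟_ (sort L) x∈)

satisfiable : Consistent L → (∀ {D} → D ∈ F → Meets L D) → Satisfiable F
satisfiable {L} (nonzero , noClash) meets =
  normalise L ,
  (normalise-strictlySorted L ,
   All.tabulate (All.lookup nonzero ∘ ∈-normalise⁻) ,
   λ x x∈ -x∈ → noClash x (∈-normalise⁻ x∈) (∈-normalise⁻ -x∈)) ,
  All.tabulate (λ D∈ → let x , x∈L , x∈D = meets D∈ in x , ∈-normalise⁺ x∈L , x∈D)

ExactlyOne : Pred A _ → List A → Set
ExactlyOne P xs = ∃[ c ] (c ∈ xs × P c × (∀ {b} → b ∈ xs → P b → b ≡ c))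

ExactlyOne-≡ : ∀ {b c : A} → ExactlyOne P xs → b ∈ xs → P b → c ∈ xs → P c → b ≡ c
ExactlyOne-≡ (_ , _ , _ , only) b∈xs Pb c∈xs Pc = trans (only b∈xs Pb) (sym (only c∈xs Pc))

unique-constant : ∀ {c : A} → Unique xs → c ∈ xs → (∀ {b} → b ∈ xs → b ≡ c) → xs ≡ [ c ]
unique-constant {xs = _ ∷ []} _ _ constant = cong [_] (constant (here refl))
unique-constant {xs = _ ∷ _ ∷ _} ((x≢x′ ∷ _) ∷ _) _ constant =
  ⊥-elim (x≢x′ (trans (constant (here refl)) (sym (constant (there (here refl))))))

length≡1 : ∀ (xs : List A) → length xs ≡ 1 → ∃[ c ] (xs ≡ [ c ])
length≡1 (c ∷ []) _ = c , refl

∈-[_] : ∀ {b c : A} → b ∈ [ c ] → b ≡ c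
∈-[_] (here b≡c) = b≡c

length-filter≡1⇒ExactlyOne : (P? : Decidable P) → length (filter P? xs) ≡ 1 → ExactlyOne P xs
length-filter≡1⇒ExactlyOne {xs = xs} P? once with length≡1 (filter P? xs) once
... | c , filtered≡[c] with ∈-filter⁻ P? (subst (c ∈_) (sym filtered≡[c]) (here refl))
... | c∈xs , Pc = c , c∈xs , Pc , λ b∈xs Pb → ∈-[_] (subst (_ ∈_) filtered≡[c] (∈-filter⁺ P? b∈xs Pb))

ExactlyOne⇒length-filter≡1 : (P? : Decidable P) → Unique xs → ExactlyOne P xs → length (filter P? xs) ≡ 1
ExactlyOne⇒length-filter≡1 P? unique (c , c∈xs , Pc , only) =
  cong length (unique-constant (AllPairs.filter⁺ P? unique) (∈-filter⁺ P? c∈xs Pc)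
                 (λ b∈ → let b∈xs , Pb = ∈-filter⁻ P? b∈ in only b∈xs Pb))

length-filter≢0⇒∃ : (P? : Decidable P) → length (filter P? xs) ≢ 0 → ∃[ c ] (c ∈ xs × P c)
length-filter≢0⇒∃ {xs = xs} P? nonempty with any? P? xs
... | yes some = find some
... | no none = ⊥-elim (nonempty (cong length (filter-none P? (All.¬Any⇒All¬ xs none))))

⊓≡1 : ∀ m n → m ⊓ n ≡ 1 → (m ≡ 1 × n ≢ 0) ⊎ (n ≡ 1 × m ≢ 0)
⊓≡1 zero _ ()
⊓≡1 (suc _) zero ()
⊓≡1 (suc zero) (suc _) _ = inj₁ (refl , λ ())
⊓≡1 (suc (suc _)) (suc zero) _ = inj₂ (refl , λ ())
⊓≡1 (suc (suc _)) (suc (suc _)) ()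

-- Clause-factors

meets-reduce : All (Meets X) (reduce G) → D ∈ G → ∃[ z ] (z ∈ X × z ∈ D × ¬ InAll G z)
meets-reduce {G = G} meetsAll D∈G =
  let z , z∈X , z∈D∖⋂G = All.lookup (All.map⁻ meetsAll) D∈G
  in  z , z∈X , ∈-filter⁻ (λ x → ¬? (all? (x ∈?_) G)) z∈D∖⋂G

head∈ : SameLits C (x ∷ E) → x ∈ C
head∈ {x = x} C≈x∷E = Equivalence.from (C≈x∷E x) (here refl)

C-or-D? : ∀ C D → Decidable (λ B → B ≡ C ⊎ B ≡ D)
C-or-D? C D B = ≡-dec _≟_ B C ⊎-dec ≡-dec _≟_ B D

-- The reduct of an fs-pair {C, D} is {{x}, {-x}}.
fsPair-reduct-unsat : C ∈ F → D ∈ F → SameLits C (x ∷ E) → SameLits D (- x ∷ E) →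
                      Unsatisfiable (reduce (filter (C-or-D? C D) F))
fsPair-reduct-unsat {C} {F} {D} {x} {E} C∈F D∈F C≈x∷E D≈-x∷E (X , (_ , X-consistent) , meetsAll) =
  proj₂ X-consistent x (head∈X C∈F (inj₁ refl) C≈x∷E) (head∈X D∈F (inj₂ refl) D≈-x∷E)
  where
  ⋂⊇E : y ∈ E → InAll (filter (C-or-D? C D) F) y
  ⋂⊇E y∈E = All.tabulate λ B∈ → case proj₂ (∈-filter⁻ (C-or-D? C D) {xs = F} B∈) of λ where
    (inj₁ refl) → Equivalence.from (C≈x∷E _) (there y∈E)
    (inj₂ refl) → Equivalence.from (D≈-x∷E _) (there y∈E)
  head∈X : ∀ {B u} → B ∈ F → (B ≡ C ⊎ B ≡ D) → SameLits B (u ∷ E) → u ∈ X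
  head∈X B∈F B≡C∨D B≈u∷E with meets-reduce meetsAll (∈-filter⁺ (C-or-D? C D) B∈F B≡C∨D)
  ... | z , z∈X , z∈B , z∉⋂ with Equivalence.to (B≈u∷E z) z∈B
  ... | here refl = z∈X
  ... | there z∈E = ⊥-elim (z∉⋂ (⋂⊇E z∈E))

TwoUnitOn : List (List Lit) → Lit → Set
TwoUnitOn F x = SameClauses F ([ x ] ∷ [ - x ] ∷ [])

twoUnitOn : [ x ] ∈ F → [ - x ] ∈ F → (∀ {E} → E ∈ F → E ≡ [ x ] ⊎ E ≡ [ - x ]) → TwoUnitOn F x
twoUnitOn [x]∈F [-x]∈F cases E = mk⇔ (to ∘ cases) from
  where
  to : E ≡ _ ⊎ E ≡ _ → E ∈ _
  to (inj₁ E≡[x]) = here E≡[x]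
  to (inj₂ E≡[-x]) = there (here E≡[-x])
  from : E ∈ _ → E ∈ _
  from (here refl) = [x]∈F
  from (there (here refl)) = [-x]∈F
  from (there (there ()))

twoUnitOn-cases : TwoUnitOn F x → E ∈ F → E ≡ [ x ] ⊎ E ≡ [ - x ]
twoUnitOn-cases same E∈F with Equivalence.to (same _) E∈F
... | here E≡[x] = inj₁ E≡[x]
... | there (here E≡[-x]) = inj₂ E≡[-x]

twoUnitOn-neg : TwoUnitOn F x → TwoUnitOn F (- x)
twoUnitOn-neg {x = x} same E rewrite neg-involutive x =
  mk⇔ (swap ∘ Equivalence.to (same E)) (Equivalence.from (same E) ∘ swap)
  where
  swap : ∀ {a b} → E ∈ a ∷ b ∷ [] → E ∈ b ∷ a ∷ []
  swap (here E≡a) = there (here E≡a)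
  swap (there (here E≡b)) = here E≡b

isTwoUnit : x ≢ 0ℤ → TwoUnitOn F x → IsTwoUnit F
isTwoUnit {x} x≢0 same with <-cmp 0ℤ x
... | tri< 0<x _ _ = x , 0<x , same
... | tri≈ _ 0≡x _ = ⊥-elim (x≢0 (sym 0≡x))
... | tri> _ _ x<0 = - x , neg-mono-< x<0 , twoUnitOn-neg same

-- Full literals

FullLiteral : List (List Lit) → Lit → Set
FullLiteral F x = ∀ E → E ∈ F → x ∈ E ⊎ - x ∈ E

HasFullLiteral : List (List Lit) → Set
HasFullLiteral F = ∃[ x ] (x ≢ 0ℤ × FullLiteral F x)

fullLiteral-neg : FullLiteral F x → FullLiteral F (- x)
fullLiteral-neg {x = x} full E E∈F with full E E∈F
... | inj₁ x∈E = inj₂ (subst (_∈ E) (sym (neg-involutive x)) x∈E)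
... | inj₂ -x∈E = inj₁ -x∈E

mentions? : ∀ x → Decidable (λ E → x ∈ E ⊎ - x ∈ E)
mentions? x E = x ∈? E ⊎-dec - x ∈? E

module Irreducible {F : List (List Lit)} (clauseSet : IsClauseSet F) (irreducible : ClauseIrreducible F)
                   (unsat : Unsatisfiable F) where

  clause-consistent : C ∈ F → Consistent C
  clause-consistent C∈F = proj₂ (All.lookup (proj₁ clauseSet) C∈F)

  clause-nonzero : C ∈ F → x ∈ C → x ≢ 0ℤ
  clause-nonzero C∈F = All.lookup (proj₁ (clause-consistent C∈F))

  clause-noClash : C ∈ F → x ∈ C → - x ∉ C
  clause-noClash C∈F = proj₂ (clause-consistent C∈F) _

  -- The disjuncts are the two ways the clause-factor filter P? F can be trivial.
  trivial-filter-factor : {P : Pred (List Lit) _} (P? : Decidable P) →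
                          C ∈ F → P C → Unsatisfiable (reduce (filter P? F)) →
                          ExactlyOne P F ⊎ (∀ {D} → D ∈ F → P D)
  trivial-filter-factor {C} P? C∈F PC reduct-unsat
    with irreducible (filter P? F) (factor-clauseSet , (λ _ → proj₁ ∘ ∈-filter⁻ P? {xs = F}) , nonempty , reduct-unsat)
    where
    factor-clauseSet : IsClauseSet (filter P? F)
    factor-clauseSet = All.filter⁺ P? (proj₁ clauseSet) , AllPairs.filter⁺ P? (proj₂ clauseSet)
    nonempty : filter P? F ≢ []
    nonempty empty with subst (C ∈_) empty (∈-filter⁺ P? C∈F PC)
    ... | ()
  ... | inj₁ once = inj₁ (length-filter≡1⇒ExactlyOne P? once)
  ... | inj₂ (_ , same) = inj₂ (λ {D} D∈F → proj₂ (∈-filter⁻ P? {xs = F} (Equivalence.from (same D) D∈F)))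

  full⇒occurs : x ≢ 0ℤ → FullLiteral F x → ∃[ C ] (C ∈ F × x ∈ C)
  full⇒occurs {x} x≢0 full with any? (x ∈?_) F
  ... | yes occurs = find occurs
  ... | no ¬occurs = ⊥-elim (unsat (satisfiable ([-]-consistent (-x≢0 x≢0)) meets))
    where
    meets : D ∈ F → Meets [ - x ] D
    meets {D} D∈F with full D D∈F
    ... | inj₁ x∈D = ⊥-elim (¬occurs (lose D∈F x∈D))
    ... | inj₂ -x∈D = - x , here refl , -x∈D

  full-reduct-unsat : x ≢ 0ℤ → FullLiteral F x → Unsatisfiable (reduce (filter (x ∈?_) F))
  full-reduct-unsat {x} x≢0 full (X , (_ , X-consistent) , meetsAll) =
    unsat (satisfiable (⊕-consistent ([-]-consistent (-x≢0 x≢0)) X-consistent) meets)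
    where
    meets : D ∈ F → Meets ([ - x ] ⊕ X) D
    meets {D} D∈F with full D D∈F
    ... | inj₂ -x∈D = - x , ∈-⊕ˡ (here refl) , -x∈D
    ... | inj₁ x∈D with meets-reduce meetsAll (∈-filter⁺ (x ∈?_) D∈F x∈D)
    ... | z , z∈X , z∈D , z∉⋂ = z , ∈-⊕ʳ z∈X -z∉[-x] , z∈D
      where
      -z∉[-x] : - z ∉ [ - x ]
      -z∉[-x] (here -z≡-x) rewrite neg-injective -z≡-x = z∉⋂ (All.all-filter (x ∈?_) F)

  full⇒occursOnce : x ≢ 0ℤ → FullLiteral F x → ExactlyOne (x ∈_) F
  full⇒occursOnce {x} x≢0 full
    with full⇒occurs x≢0 full
  ... | C , C∈F , x∈C
    with trivial-filter-factor (x ∈?_) C∈F x∈C (full-reduct-unsat x≢0 full)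
  ... | inj₁ once = once
  ... | inj₂ everywhere =
    let D , D∈F , -x∈D = full⇒occurs (-x≢0 x≢0) (fullLiteral-neg full)
    in  ⊥-elim (clause-noClash D∈F (everywhere D∈F) -x∈D)

  -- A second literal y of the only clause containing x would make {y, -x} satisfy F.
  occursOnce⇒unit : x ≢ 0ℤ → FullLiteral F x → C ∈ F → x ∈ C → (∀ {E} → E ∈ F → x ∈ E → E ≡ C) → C ≡ [ x ]
  occursOnce⇒unit {x} {C} x≢0 full C∈F x∈C only =
    unique-constant (AllPairs.map <⇒≢ (Linked⇒AllPairs <-trans (proj₁ (All.lookup (proj₁ clauseSet) C∈F))))
                    x∈C only-x
    where
    only-x : ∀ {y} → y ∈ C → y ≡ x
    only-x {y} y∈C with y ≟ x
    ... | yes y≡x = y≡x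
    ... | no y≢x = ⊥-elim (unsat (satisfiable consistent meets))
      where
      consistent : Consistent ([ y ] ⊕ [ - x ])
      consistent = ⊕-consistent ([-]-consistent (clause-nonzero C∈F y∈C)) ([-]-consistent (-x≢0 x≢0))
      meets : D ∈ F → Meets ([ y ] ⊕ [ - x ]) D
      meets {D} D∈F with full D D∈F
      ... | inj₁ x∈D = y , ∈-⊕ˡ (here refl) , subst (y ∈_) (sym (only D∈F x∈D)) y∈C
      ... | inj₂ -x∈D = - x , ∈-⊕ʳ (here refl) x∉[y] , -x∈D
        where
        x∉[y] : - - x ∉ [ y ]
        x∉[y] (here x≡y) = y≢x (trans (sym x≡y) (neg-involutive x))

  full⇒unit : x ≢ 0ℤ → FullLiteral F x → E ∈ F → x ∈ E → E ≡ [ x ]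
  full⇒unit x≢0 full E∈F x∈E with full⇒occursOnce x≢0 full
  ... | C , C∈F , x∈C , only = trans (only E∈F x∈E) (occursOnce⇒unit x≢0 full C∈F x∈C only)

  full⇒twoUnitOn : x ≢ 0ℤ → FullLiteral F x → TwoUnitOn F x
  full⇒twoUnitOn {x} x≢0 full = twoUnitOn (unit-∈ x≢0 full) (unit-∈ (-x≢0 x≢0) (fullLiteral-neg full)) cases
    where
    unit-∈ : ∀ {y} → y ≢ 0ℤ → FullLiteral F y → [ y ] ∈ F
    unit-∈ y≢0 full′ = let E , E∈F , y∈E = full⇒occurs y≢0 full′
                       in  subst (_∈ F) (full⇒unit y≢0 full′ E∈F y∈E) E∈F
    cases : E ∈ F → E ≡ [ x ] ⊎ E ≡ [ - x ]
    cases {E} E∈F with full E E∈F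
    ... | inj₁ x∈E = inj₁ (full⇒unit x≢0 full E∈F x∈E)
    ... | inj₂ -x∈E = inj₂ (full⇒unit (-x≢0 x≢0) (fullLiteral-neg full) E∈F -x∈E)

  fullLiteral⇒twoUnit : HasFullLiteral F → IsTwoUnit F
  fullLiteral⇒twoUnit (x , x≢0 , full) = isTwoUnit x≢0 (full⇒twoUnitOn x≢0 full)

  fullVar⇒fullLiteral : ∃[ v ] FullVar F v → HasFullLiteral F
  fullVar⇒fullLiteral (v , (0<v , _) , full) = v , var≢0 0<v , full

  fsPair⇒fullLiteral : HasFsPair F → HasFullLiteral F
  fsPair⇒fullLiteral (E , v , _ , _ , (C , C∈F , C≈v∷E) , (D , D∈F , D≈-v∷E))
    with trivial-filter-factor (C-or-D? C D) C∈F (inj₁ refl)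
           (fsPair-reduct-unsat C∈F D∈F C≈v∷E D≈-v∷E)
  ... | inj₁ once = ⊥-elim (clause-noClash C∈F (head∈ C≈v∷E)
                                (subst (- v ∈_) (ExactlyOne-≡ once D∈F (inj₂ refl) C∈F (inj₁ refl)) (head∈ D≈-v∷E)))
  ... | inj₂ all-C-or-D = v , clause-nonzero C∈F (head∈ C≈v∷E) , λ B B∈F → case all-C-or-D B∈F of λ where
    (inj₁ refl) → inj₁ (head∈ C≈v∷E)
    (inj₂ refl) → inj₂ (head∈ D≈-v∷E)

  module WithHitting (hitting : Hitting F) where

    unit⇒full : [ x ] ∈ F → FullLiteral F x
    unit⇒full {x} [x]∈F E E∈F with x ∈? E
    ... | yes x∈E = inj₁ x∈E
    ... | no x∉E with hitting [ x ] E [x]∈F E∈F (λ [x]≡E → x∉E (subst (x ∈_) [x]≡E (here refl)))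
    ... | _ , here refl , -x∈E = inj₂ -x∈E

    -- If x occurs only in C, then C ∖ {x} is contained in every clause D containing -x:
    -- otherwise {-x, a} ∪ -(D ∖ {-x}) satisfies F, with a ∈ C ∖ D.
    occursOnce-subsumes : C ∈ F → x ∈ C → (∀ {E} → E ∈ F → x ∈ E → E ≡ C) →
                          D ∈ F → - x ∈ D → a ∈ C → a ≢ x → a ∈ D
    occursOnce-subsumes {C} {x} {D} {a} C∈F x∈C only D∈F -x∈D a∈C a≢x with a ∈? D
    ... | yes a∈D = a∈D
    ... | no a∉D = ⊥-elim (unsat (satisfiable consistent meets))
      where
      -a∉[-x] : - a ∉ [ - x ]
      -a∉[-x] (here -a≡-x) = a≢x (neg-injective -a≡-x)
      consistent : Consistent (([ - x ] ⊕ [ a ]) ⊕ map -_ D)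
      consistent = ⊕-consistent (⊕-consistent ([-]-consistent (-x≢0 (clause-nonzero C∈F x∈C)))
                                               ([-]-consistent (clause-nonzero C∈F a∈C)))
                                 (neg-consistent (clause-consistent D∈F))
      meets : E ∈ F → Meets (([ - x ] ⊕ [ a ]) ⊕ map -_ D) E
      meets {E} E∈F with - x ∈? E
      ... | yes -x∈E = - x , ∈-⊕ˡ (∈-⊕ˡ (here refl)) , -x∈E
      ... | no -x∉E with hitting D E D∈F E∈F (λ D≡E → -x∉E (subst (- x ∈_) D≡E -x∈D))
      ... | y , y∈D , -y∈E with y ≟ - x
      ... | yes refl = a , ∈-⊕ˡ (∈-⊕ʳ (here refl) -a∉[-x]) , subst (a ∈_) (sym (only E∈F x∈E)) a∈C
        where
        x∈E : x ∈ E
        x∈E = subst (_∈ E) (neg-involutive x) -y∈E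
      ... | no y≢-x = - y , ∈-⊕ʳ (∈-map⁺ -_ y∈D) y∉ , -y∈E
        where
        y∉ : - - y ∉ [ - x ] ⊕ [ a ]
        y∉ y∈ with ∈-⊕⁻ y∈
        ... | inj₁ (here y≡-x) = y≢-x (trans (sym (neg-involutive y)) y≡-x)
        ... | inj₂ (here y≡a , _) = a∉D (subst (_∈ D) (trans (sym (neg-involutive y)) y≡a) y∈D)

    -- A satisfier X of the reduct must contain x, and then {x} ∪ -C ∪ X (minus clashes) satisfies F.
    occursOnce-reduct-unsat : C ∈ F → x ∈ C → (∀ {E} → E ∈ F → x ∈ E → E ≡ C) →
                              Unsatisfiable (reduce (filter (mentions? x) F))
    occursOnce-reduct-unsat {C} {x} C∈F x∈C only (X , (_ , X-consistent) , meetsAll) =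
      unsat (satisfiable (⊕-consistent base-consistent X-consistent) meets)
      where
      ⋂⊇C∖x : a ∈ C → a ≢ x → InAll (filter (mentions? x) F) a
      ⋂⊇C∖x a∈C a≢x = All.tabulate λ E∈ → case ∈-filter⁻ (mentions? x) {xs = F} E∈ of λ where
        (E∈F , inj₁ x∈E) → subst (_ ∈_) (sym (only E∈F x∈E)) a∈C
        (E∈F , inj₂ -x∈E) → occursOnce-subsumes C∈F x∈C only E∈F -x∈E a∈C a≢x
      x∈X : x ∈ X
      x∈X with meets-reduce meetsAll (∈-filter⁺ (mentions? x) C∈F (inj₁ x∈C))
      ... | z , z∈X , z∈C , z∉⋂ with z ≟ x
      ... | yes refl = z∈X
      ... | no z≢x = ⊥-elim (z∉⋂ (⋂⊇C∖x z∈C z≢x))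
      base : List Lit
      base = [ x ] ⊕ map -_ C
      base-consistent : Consistent base
      base-consistent = ⊕-consistent ([-]-consistent (clause-nonzero C∈F x∈C)) (neg-consistent (clause-consistent C∈F))
      meets : E ∈ F → Meets (base ⊕ X) E
      meets {E} E∈F with x ∈? E
      ... | yes x∈E = x , ∈-⊕ˡ (∈-⊕ˡ (here refl)) , x∈E
      ... | no x∉E with - x ∈? E
      ... | yes -x∈E with meets-reduce meetsAll (∈-filter⁺ (mentions? x) E∈F (inj₂ -x∈E))
      ... | z , z∈X , z∈E , z∉⋂ = z , ∈-⊕ʳ z∈X -z∉base , z∈E
        where
        -z∉base : - z ∉ base
        -z∉base -z∈ with ∈-⊕⁻ -z∈
        ... | inj₁ (here -z≡x) =
          proj₂ X-consistent x x∈X (subst (_∈ X) (trans (sym (neg-involutive z)) (cong -_ -z≡x)) z∈X)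
        ... | inj₂ (-z∈-C , _) =
          z∉⋂ (⋂⊇C∖x (subst (_∈ C) (neg-involutive z) (∈-neg⁻ -z∈-C)) (λ { refl → x∉E z∈E }))
      meets {E} E∈F | no x∉E | no -x∉E with hitting C E C∈F E∈F (λ C≡E → x∉E (subst (x ∈_) C≡E x∈C))
      ... | y , y∈C , -y∈E = - y , ∈-⊕ˡ (∈-⊕ʳ (∈-map⁺ -_ y∈C) y∉[x]) , -y∈E
        where
        y∉[x] : - - y ∉ [ x ]
        y∉[x] (here y≡x) = -x∉E (subst (λ t → - t ∈ E) (trans (sym (neg-involutive y)) y≡x) -y∈E)

    occursOnce⇒full : C ∈ F → x ∈ C → (∀ {E} → E ∈ F → x ∈ E → E ≡ C) → D ∈ F → - x ∈ D → FullLiteral F x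
    occursOnce⇒full {C} {x} {D} C∈F x∈C only D∈F -x∈D
      with trivial-filter-factor (mentions? x) C∈F (inj₁ x∈C)
             (occursOnce-reduct-unsat C∈F x∈C only)
    ... | inj₁ once =
      ⊥-elim (clause-noClash C∈F x∈C (subst (- x ∈_) (ExactlyOne-≡ once D∈F (inj₂ -x∈D) C∈F (inj₁ x∈C)) -x∈D))
    ... | inj₂ everyClause = λ E E∈F → everyClause E∈F

    singular⇒full : ldeg F x ≡ 1 → ldeg F (- x) ≢ 0 → FullLiteral F x
    singular⇒full {x} once occurs
      with length-filter≡1⇒ExactlyOne (x ∈?_) once | length-filter≢0⇒∃ (- x ∈?_) occurs
    ... | C , C∈F , x∈C , only | D , D∈F , -x∈D = occursOnce⇒full C∈F x∈C only D∈F -x∈D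

    singularVar⇒fullLiteral : ∃[ v ] SingularVar F v → HasFullLiteral F
    singularVar⇒fullLiteral (v , (0<v , _) , ldeg⊓≡1) with ⊓≡1 (ldeg F v) (ldeg F (- v)) ldeg⊓≡1
    ... | inj₁ (once , occurs) = v , var≢0 0<v , singular⇒full once occurs
    ... | inj₂ (once , occurs) =
      - v , -x≢0 (var≢0 0<v) , singular⇒full once (subst (λ u → ldeg F u ≢ 0) (sym (neg-involutive v)) occurs)

    unitClause⇒fullLiteral : HasUnitClause F → HasFullLiteral F
    unitClause⇒fullLiteral (C , C∈F , |C|≡1) with length≡1 C |C|≡1
    ... | x , refl = x , clause-nonzero C∈F (here refl) , unit⇒full C∈F

module _ {F : List (List Lit)} {w : Lit} (0<w : 0ℤ < w) (same : TwoUnitOn F w) where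

  private
    w≢-w : w ≢ - w
    w≢-w w≡-w = -x≢x (var≢0 0<w) (sym w≡-w)

    [w]∈F : [ w ] ∈ F
    [w]∈F = Equivalence.from (same _) (here refl)

    [-w]∈F : [ - w ] ∈ F
    [-w]∈F = Equivalence.from (same _) (there (here refl))

  twoUnitOn⇒fullVar : FullVar F w
  twoUnitOn⇒fullVar = (0<w , [ w ] , [w]∈F , inj₁ (here refl)) , λ E E∈F → case twoUnitOn-cases same E∈F of λ where
    (inj₁ refl) → inj₁ (here refl)
    (inj₂ refl) → inj₂ (here refl)

  twoUnitOn⇒singularVar : Unique F → SingularVar F w
  twoUnitOn⇒singularVar unique =
    proj₁ twoUnitOn⇒fullVar ,
    cong₂ _⊓_ (ExactlyOne⇒length-filter≡1 (w ∈?_) unique ([ w ] , [w]∈F , here refl , only-[w]))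
              (ExactlyOne⇒length-filter≡1 (- w ∈?_) unique ([ - w ] , [-w]∈F , here refl , only-[-w]))
    where
    only-[w] : E ∈ F → w ∈ E → E ≡ [ w ]
    only-[w] E∈F w∈E with twoUnitOn-cases same E∈F
    ... | inj₁ E≡[w] = E≡[w]
    ... | inj₂ refl = ⊥-elim (w≢-w (∈-[_] w∈E))
    only-[-w] : E ∈ F → - w ∈ E → E ≡ [ - w ]
    only-[-w] E∈F -w∈E with twoUnitOn-cases same E∈F
    ... | inj₁ refl = ⊥-elim (w≢-w (sym (∈-[_] -w∈E)))
    ... | inj₂ E≡[-w] = E≡[-w]

  twoUnitOn⇒fsPair : HasFsPair F
  twoUnitOn⇒fsPair = [] , w , (λ ()) , (λ ()) , ([ w ] , [w]∈F , λ _ → mk⇔ id id) , ([ - w ] , [-w]∈F , λ _ → mk⇔ id id)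

  twoUnitOn⇒unitClause : HasUnitClause F
  twoUnitOn⇒unitClause = [ w ] , [w]∈F , refl

lemma18 : (F : List (List ℤ)) → IsClauseSet F → ClauseIrreducible F → Unsatisfiable F → Hitting F →
    (((∃[ v ] SingularVar F v) ⇔ IsTwoUnit F) ×
     ((∃[ v ] FullVar F v) ⇔ IsTwoUnit F) ×
     (HasFsPair F ⇔ IsTwoUnit F) ×
     (HasUnitClause F ⇔ IsTwoUnit F))
lemma18 F clauseSet irreducible unsat hitting =
  mk⇔ (fullLiteral⇒twoUnit ∘ singularVar⇒fullLiteral)
      (λ (w , 0<w , same) → w , twoUnitOn⇒singularVar 0<w same (proj₂ clauseSet)) ,
  mk⇔ (fullLiteral⇒twoUnit ∘ fullVar⇒fullLiteral) (λ (w , 0<w , same) → w , twoUnitOn⇒fullVar 0<w same) ,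
  mk⇔ (fullLiteral⇒twoUnit ∘ fsPair⇒fullLiteral) (λ (w , 0<w , same) → twoUnitOn⇒fsPair 0<w same) ,
  mk⇔ (fullLiteral⇒twoUnit ∘ unitClause⇒fullLiteral) (λ (w , 0<w , same) → twoUnitOn⇒unitClause 0<w same)
  where
  open Irreducible clauseSet irreducible unsat
  open WithHitting hitting
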